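{- Let $R_1$ and $R_2$ be commutative rings with unity such that $\Gamma(R_1)$ has $m$ vertices and $\Gamma(R_2)$ has $n$ vertices, with maximum degrees $\Delta(\Gamma(R_1))=r_1$ and $\Delta(\Gamma(R_2))=r_2$. Then $\gamma_R(\Gamma(R_1)\,\Box\,\Gamma(R_2))\le mn-r_1-r_2+1$.
   Context: For a commutative ring $R$ with unity, $Z(R)$ denotes its set of zero-divisors and the zero-divisor graph $\Gamma(R)$ is the simple undirected graph with vertex set $Z(R)\setminus\{0\}$, in which distinct vertices $x,y$ are adjacent if and only if $xy=0$. $\Delta(G)$ is the maximum vertex degree of $G$. The Cartesian product $G\,\Box\,H$ of graphs $G,H$ has vertex set $V(G)\times V(H)$, and $(x_1,y_1)$, $(x_2,y_2)$ are adjacent iff either $x_1=x_2$ and $y_1y_2$ is an edge of $H$, or $y_1=y_2$ and $x_1x_2$ is an edge of $G$. For a graph $G=(V,E)$, a Roman dominating function is a map $f:V\to\{0,1,2\}$ such that every vertex $u$ with $f(u)=0$ is adjacent to at least one vertex $v$ with $f(v)=2$; its weight is $\sum_{u\in V} f(u)$, and the Roman domination number $\gamma_R(G)$ is the minimum weight of a Roman dominating function on $G$. -}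

module Defs where

open import Level using (Level; _⊔_)
open import Data.Nat using (ℕ; zero; suc; _+_; _≤_)
open import Data.Fin using (Fin; zero; suc)
open import Data.Product using (Σ; ∃; _×_; _,_)
open import Relation.Nullary using (¬_)
open import Relation.Binary.PropositionalEquality using (_≡_; _≢_)
open import Function.Definitions using (Injective)
open import Algebra.Bundles using (CommutativeRing)

Graph : ℕ → Set₁
Graph m = Fin m → Fin m → Set

module _ {c ℓ : Level} (R : CommutativeRing c ℓ) where
  open CommutativeRing R

  IsZeroDivisor : Carrier → Set (c ⊔ ℓ)
  IsZeroDivisor x = Σ Carrier λ y → (¬ (y ≈ 0#)) × ((x * y) ≈ 0#)

  IsZDVertex : Carrier → Set (c ⊔ ℓ)
  IsZDVertex x = (¬ (x ≈ 0#)) × IsZeroDivisor x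

  -- An enumeration of the vertex set of Γ(R) (up to the ring's equality)
  -- by Fin m: "Γ(R) has exactly m vertices".
  record ZDEnum (m : ℕ) : Set (c ⊔ ℓ) where
    field
      vertex    : Fin m → Carrier
      isVertex  : ∀ i → IsZDVertex (vertex i)
      injective : ∀ i j → vertex i ≈ vertex j → i ≡ j
      complete  : ∀ x → IsZDVertex x → Σ (Fin m) λ i → x ≈ vertex i

  ZDGraph : ∀ {m} → ZDEnum m → Fin m → Fin m → Set ℓ
  ZDGraph e i j = (i ≢ j) × ((ZDEnum.vertex e i * ZDEnum.vertex e j) ≈ 0#)

module _ {a} {m : ℕ} (Adj : Fin m → Fin m → Set a) where

  HasDegree : Fin m → ℕ → Set a
  HasDegree i d = Σ (Fin d → Fin m) λ g →
      Injective _≡_ _≡_ g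
    × (∀ k → Adj i (g k))
    × (∀ j → Adj i j → Σ (Fin d) λ k → g k ≡ j)

  MaxDegree : ℕ → Set a
  MaxDegree r = (∀ i d → HasDegree i d → d ≤ r) × Σ (Fin m) λ i → HasDegree i r

module _ {a b} {m n : ℕ} (G : Fin m → Fin m → Set a) (H : Fin n → Fin n → Set b) where
  CartAdj : Fin m × Fin n → Fin m × Fin n → Set (a ⊔ b)
  CartAdj (x₁ , y₁) (x₂ , y₂) =
    Data.Sum._⊎_ ((x₁ ≡ x₂) × Level.Lift a (H y₁ y₂))
                 ((y₁ ≡ y₂) × Level.Lift b (G x₁ x₂))
    where import Data.Sum

sumFin : ∀ {k} → (Fin k → ℕ) → ℕ
sumFin {zero}  f = 0
sumFin {suc k} f = f zero + sumFin (λ i → f (suc i))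

weight : ∀ {m n} → (Fin m × Fin n → ℕ) → ℕ
weight f = sumFin (λ i → sumFin (λ j → f (i , j)))

module _ {a} {V : Set} (Adj : V → V → Set a) where
  IsRomanDominating : (V → ℕ) → Set a
  IsRomanDominating f =
      (∀ v → f v ≤ 2)
    × (∀ v → f v ≡ 0 → Σ V λ u → Adj v u × f u ≡ 2)

{-# OPTIONS --safe #-}
-- Take u of degree r₁ in Γ(R₁) and v of degree r₂ in Γ(R₂). In the Cartesian
-- product (u , v) has the r₁ + r₂ distinct neighbours (N(u) , v) and (u , N(v)).
-- Weight 2 at (u , v), 0 on these neighbours and 1 on the remaining
-- mn − r₁ − r₂ − 1 vertices is a Roman dominating function of weight
-- mn − r₁ − r₂ + 1.
module Submission where

open import Defs
open import Level using (Level; lift)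
open import Data.Nat using (ℕ; zero; suc; _+_; _*_; _≤_; z≤n; s≤s)
open import Data.Nat.Properties using (+-suc; +-comm; +-assoc; +-identityʳ; +-mono-≤; *-identityʳ; ≤-refl; ≤-trans; ≤-reflexive; module ≤-Reasoning)
open import Data.Fin using (Fin; zero; suc; splitAt; join)
import Data.Fin as Fin
open import Data.Fin.Properties using (any?; suc-injective; 0≢1+n; join-splitAt)
open import Data.Product using (Σ; ∃; _×_; _,_; proj₁; proj₂)
open import Data.Product.Properties using (≡-dec)
open import Data.Sum using (_⊎_; inj₁; inj₂)
open import Data.Empty using (⊥-elim)
open import Function using (_∘_)
open import Function.Definitions using (Injective)
open import Relation.Nullary using (yes; no)
open import Relation.Binary.Definitions using (DecidableEquality; Symmetric; Irreflexive)
open import Relation.Binary.PropositionalEquality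
  using (_≡_; _≢_; refl; sym; trans; cong; cong₂; subst; module ≡-Reasoning)
open import Algebra.Bundles using (CommutativeRing)

sumFin-cong : ∀ {k} {f g : Fin k → ℕ} → (∀ i → f i ≡ g i) → sumFin f ≡ sumFin g
sumFin-cong {zero}  f≗g = refl
sumFin-cong {suc k} f≗g = cong₂ _+_ (f≗g zero) (sumFin-cong (f≗g ∘ suc))

sumFin-suc-at : ∀ {k} {f g : Fin k → ℕ} (j : Fin k) → g j ≡ suc (f j) →
                (∀ i → i ≢ j → g i ≡ f i) → sumFin g ≡ suc (sumFin f)
sumFin-suc-at zero    gj≡1+fj g≗f = cong₂ _+_ gj≡1+fj (sumFin-cong (λ i → g≗f (suc i) λ ()))
sumFin-suc-at {f = f} {g} (suc j) gj≡1+fj g≗f = begin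
  g zero + sumFin (g ∘ suc)       ≡⟨ cong₂ _+_ (g≗f zero λ ()) (sumFin-suc-at j gj≡1+fj g∘suc≗f∘suc) ⟩
  f zero + suc (sumFin (f ∘ suc)) ≡⟨ +-suc (f zero) _ ⟩
  suc (sumFin f)                  ∎
  where
  open ≡-Reasoning
  g∘suc≗f∘suc : ∀ i → i ≢ j → g (suc i) ≡ f (suc i)
  g∘suc≗f∘suc i i≢j = g≗f (suc i) (i≢j ∘ suc-injective)

sumFin-≤ : ∀ {k} {f : Fin k → ℕ} c → (∀ i → f i ≤ c) → sumFin f ≤ k * c
sumFin-≤ {zero}  c f≤c = z≤n
sumFin-≤ {suc k} c f≤c = +-mono-≤ (f≤c zero) (sumFin-≤ c (f≤c ∘ suc))

record Star {a} {V : Set} (Adj : V → V → Set a) (centre : V) (d : ℕ) : Set a where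
  field
    leaf           : Fin d → V
    leaf-injective : Injective _≡_ _≡_ leaf
    leaf≢centre    : ∀ k → leaf k ≢ centre
    leaf-adjacent  : ∀ k → Adj (leaf k) centre

hasDegree⇒star : ∀ {a m} {Adj : Fin m → Fin m → Set a} {i d} →
                 Symmetric Adj → Irreflexive _≡_ Adj → HasDegree Adj i d → Star Adj i d
hasDegree⇒star sym-Adj irrefl-Adj (g , g-inj , adjacent , _) = record
  { leaf           = g
  ; leaf-injective = g-inj
  ; leaf≢centre    = λ k gk≡i → irrefl-Adj (sym gk≡i) (adjacent k)
  ; leaf-adjacent  = sym-Adj ∘ adjacent
  }

module _ {c ℓ} (R : CommutativeRing c ℓ) {m} (e : ZDEnum R m) where
  open CommutativeRing R using (*-comm) renaming (trans to ≈-trans)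

  ZDGraph-sym : Symmetric (ZDGraph R e)
  ZDGraph-sym (i≢j , xy≈0) = i≢j ∘ sym , ≈-trans (*-comm _ _) xy≈0

  ZDGraph-irrefl : Irreflexive _≡_ (ZDGraph R e)
  ZDGraph-irrefl i≡j (i≢j , _) = i≢j i≡j

cartesian-star : ∀ {a b m n} {G : Fin m → Fin m → Set a} {H : Fin n → Fin n → Set b}
                 {u v r₁ r₂} → Star G u r₁ → Star H v r₂ → Star (CartAdj G H) (u , v) (r₁ + r₂)
cartesian-star {G = G} {H} {u} {v} {r₁} {r₂} star₁ star₂ = record
  { leaf           = leaf ∘ splitAt r₁
  ; leaf-injective = λ eq → splitAt-injective (leaf-injective eq)
  ; leaf≢centre    = leaf≢centre ∘ splitAt r₁
  ; leaf-adjacent  = leaf-adjacent ∘ splitAt r₁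
  }
  where
  module S₁ = Star star₁
  module S₂ = Star star₂

  leaf : Fin r₁ ⊎ Fin r₂ → Fin _ × Fin _
  leaf (inj₁ k) = S₁.leaf k , v
  leaf (inj₂ k) = u , S₂.leaf k

  leaf-injective : Injective _≡_ _≡_ leaf
  leaf-injective {inj₁ k} {inj₁ k′} eq = cong inj₁ (S₁.leaf-injective (cong proj₁ eq))
  leaf-injective {inj₁ k} {inj₂ k′} eq = ⊥-elim (S₁.leaf≢centre k (cong proj₁ eq))
  leaf-injective {inj₂ k} {inj₁ k′} eq = ⊥-elim (S₁.leaf≢centre k′ (sym (cong proj₁ eq)))
  leaf-injective {inj₂ k} {inj₂ k′} eq = cong inj₂ (S₂.leaf-injective (cong proj₂ eq))

  splitAt-injective : Injective _≡_ _≡_ (splitAt r₁ {r₂})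
  splitAt-injective {k} {k′} eq =
    trans (sym (join-splitAt r₁ r₂ k)) (trans (cong (join r₁ r₂) eq) (join-splitAt r₁ r₂ k′))

  leaf≢centre : ∀ s → leaf s ≢ (u , v)
  leaf≢centre (inj₁ k) = S₁.leaf≢centre k ∘ cong proj₁
  leaf≢centre (inj₂ k) = S₂.leaf≢centre k ∘ cong proj₂

  leaf-adjacent : ∀ s → CartAdj G H (leaf s) (u , v)
  leaf-adjacent (inj₁ k) = inj₂ (refl , lift (S₁.leaf-adjacent k))
  leaf-adjacent (inj₂ k) = inj₁ (refl , lift (S₂.leaf-adjacent k))

module _ {m n : ℕ} where

  Vertex : Set
  Vertex = Fin m × Fin n

  _≟_ : DecidableEquality Vertex
  _≟_ = ≡-dec Fin._≟_ Fin._≟_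

  weight-suc-at : ∀ {f g : Vertex → ℕ} (p : Vertex) → g p ≡ suc (f p) →
                  (∀ q → q ≢ p → g q ≡ f q) → weight g ≡ suc (weight f)
  weight-suc-at (i , j) gp≡1+fp g≗f =
    sumFin-suc-at i (sumFin-suc-at j gp≡1+fp (λ j′ j′≢j → g≗f (i , j′) (j′≢j ∘ cong proj₂)))
                    (λ i′ i′≢i → sumFin-cong (λ j′ → g≗f (i′ , j′) (i′≢i ∘ cong proj₁)))

  weight-≤ : ∀ {f : Vertex → ℕ} → (∀ p → f p ≤ 1) → weight f ≤ m * n
  weight-≤ {f} f≤1 = sumFin-≤ n row≤n
    where
    row≤n : ∀ i → sumFin (λ j → f (i , j)) ≤ n
    row≤n i = subst (sumFin (λ j → f (i , j)) ≤_) (*-identityʳ n) (sumFin-≤ 1 (λ j → f≤1 (i , j)))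

  raise : Vertex → (Vertex → ℕ) → Vertex → ℕ
  raise p f q with q ≟ p
  ... | yes _ = suc (f q)
  ... | no  _ = f q

  raise-self : ∀ p (f : Vertex → ℕ) → raise p f p ≡ suc (f p)
  raise-self p f with p ≟ p
  ... | yes _   = refl
  ... | no  p≢p = ⊥-elim (p≢p refl)

  raise-other : ∀ {p q} (f : Vertex → ℕ) → q ≢ p → raise p f q ≡ f q
  raise-other {p} {q} f q≢p with q ≟ p
  ... | yes q≡p = ⊥-elim (q≢p q≡p)
  ... | no  _   = refl

  weight-raise : ∀ p (f : Vertex → ℕ) → weight (raise p f) ≡ suc (weight f)
  weight-raise p f = weight-suc-at p (raise-self p f) (λ q → raise-other f)

  weight+zeros≤m*n : ∀ {d} (g : Fin d → Vertex) → Injective _≡_ _≡_ g →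
                     (f : Vertex → ℕ) → (∀ p → f p ≤ 1) → (∀ k → f (g k) ≡ 0) →
                     weight f + d ≤ m * n
  weight+zeros≤m*n {zero} g g-inj f f≤1 f∘g≡0 =
    subst (_≤ m * n) (sym (+-identityʳ (weight f))) (weight-≤ f≤1)
  weight+zeros≤m*n {suc d} g g-inj f f≤1 f∘g≡0 =
    subst (_≤ m * n) weight-shift
      (weight+zeros≤m*n (g ∘ suc) (suc-injective ∘ g-inj) f′ f′≤1 f′∘g∘suc≡0)
    where
    f′ : Vertex → ℕ
    f′ = raise (g zero) f

    f′≤1 : ∀ p → f′ p ≤ 1
    f′≤1 p with p ≟ g zero
    ... | yes refl = s≤s (≤-reflexive (f∘g≡0 zero))
    ... | no  _    = f≤1 p

    f′∘g∘suc≡0 : ∀ k → f′ (g (suc k)) ≡ 0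
    f′∘g∘suc≡0 k = trans (raise-other f (0≢1+n ∘ sym ∘ g-inj)) (f∘g≡0 (suc k))

    weight-shift : weight f′ + d ≡ weight f + suc d
    weight-shift = begin
      weight f′ + d       ≡⟨ cong (_+ d) (weight-raise (g zero) f) ⟩
      suc (weight f) + d  ≡⟨ +-suc (weight f) d ⟨
      weight f + suc d    ∎
      where open ≡-Reasoning

  module _ {a} {Adj : Vertex → Vertex → Set a} {centre : Vertex} {d : ℕ}
           (star : Star Adj centre d) where
    open Star star

    nonLeaf : Vertex → ℕ
    nonLeaf p with any? (λ k → leaf k ≟ p)
    ... | yes _ = 0
    ... | no  _ = 1

    nonLeaf≤1 : ∀ p → nonLeaf p ≤ 1
    nonLeaf≤1 p with any? (λ k → leaf k ≟ p)
    ... | yes _ = z≤n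
    ... | no  _ = ≤-refl

    nonLeaf-leaf : ∀ k → nonLeaf (leaf k) ≡ 0
    nonLeaf-leaf k with any? (λ k′ → leaf k′ ≟ leaf k)
    ... | yes _   = refl
    ... | no  ∄k′ = ⊥-elim (∄k′ (k , refl))

    nonLeaf-centre : nonLeaf centre ≡ 1
    nonLeaf-centre with any? (λ k → leaf k ≟ centre)
    ... | yes (k , leafk≡centre) = ⊥-elim (leaf≢centre k leafk≡centre)
    ... | no  _                  = refl

    nonLeaf≡0⇒leaf : ∀ p → nonLeaf p ≡ 0 → ∃ λ k → leaf k ≡ p
    nonLeaf≡0⇒leaf p _ with any? (λ k → leaf k ≟ p)
    ... | yes leafk≡p = leafk≡p
    nonLeaf≡0⇒leaf p ()         | no _

    starFunction : Vertex → ℕ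
    starFunction = raise centre nonLeaf

    starFunction-centre : starFunction centre ≡ 2
    starFunction-centre = trans (raise-self centre nonLeaf) (cong suc nonLeaf-centre)

    starFunction-isRomanDominating : IsRomanDominating Adj starFunction
    starFunction-isRomanDominating = ≤2 , dominated
      where
      ≤2 : ∀ p → starFunction p ≤ 2
      ≤2 p with p ≟ centre
      ... | yes _ = s≤s (nonLeaf≤1 p)
      ... | no  _ = ≤-trans (nonLeaf≤1 p) (s≤s z≤n)

      dominated : ∀ p → starFunction p ≡ 0 → Σ Vertex λ q → Adj p q × starFunction q ≡ 2
      dominated p fp≡0 with p ≟ centre
      dominated p ()   | yes _
      ... | no _ with nonLeaf≡0⇒leaf p fp≡0
      ...   | k , refl = centre , leaf-adjacent k , starFunction-centre

    starFunction-weight : weight starFunction + d ≤ m * n + 1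
    starFunction-weight = begin
      weight starFunction + d    ≡⟨ cong (_+ d) (weight-raise centre nonLeaf) ⟩
      suc (weight nonLeaf + d)   ≤⟨ s≤s (weight+zeros≤m*n leaf leaf-injective nonLeaf nonLeaf≤1 nonLeaf-leaf) ⟩
      suc (m * n)                ≡⟨ +-comm 1 (m * n) ⟩
      m * n + 1                  ∎
      where open ≤-Reasoning

proposition3p1 : ∀ {c₁ ℓ₁ c₂ ℓ₂ : Level}
    (R₁ : CommutativeRing c₁ ℓ₁) (R₂ : CommutativeRing c₂ ℓ₂)
    (m n r₁ r₂ : ℕ) (e₁ : ZDEnum R₁ m) (e₂ : ZDEnum R₂ n) →
    MaxDegree (ZDGraph R₁ e₁) r₁ →
    MaxDegree (ZDGraph R₂ e₂) r₂ →
    Σ (Fin m × Fin n → ℕ) λ f →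
      IsRomanDominating (CartAdj (ZDGraph R₁ e₁) (ZDGraph R₂ e₂)) f
      × weight f + r₁ + r₂ ≤ m * n + 1
proposition3p1 R₁ R₂ m n r₁ r₂ e₁ e₂ (_ , u , deg-u) (_ , v , deg-v) =
  starFunction star , starFunction-isRomanDominating star ,
  subst (_≤ m * n + 1) (sym (+-assoc _ r₁ r₂)) (starFunction-weight star)
  where
  star : Star (CartAdj (ZDGraph R₁ e₁) (ZDGraph R₂ e₂)) (u , v) (r₁ + r₂)
  star = cartesian-star
    (hasDegree⇒star (ZDGraph-sym R₁ e₁) (ZDGraph-irrefl R₁ e₁) deg-u)
    (hasDegree⇒star (ZDGraph-sym R₂ e₂) (ZDGraph-irrefl R₂ e₂) deg-v)
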